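{- There exist an absolute constant $C>0$ and an integer $N_0$ such that the following holds. Let $n \ge 1$ be an integer, let $p$ be a prime with $4n < p < 8n$, and let $(a,b,c,d,e)$ be chosen uniformly at random from the set $\{(a,b,c,d,e) \in \mathbb{F}_p^5 : ad-bc \neq 0\}$. Let $$A = \{(x,y) \in \{0,\dots,n-1\}^2 : (ax+by)^2 \equiv cx+dy+e \pmod p\}.$$ Then with probability at least $0.9$, $\big| |A| - n^2/p \big| \leq C\sqrt{n}$. In particular, there are absolute constants $c_1,c_2>0$ such that for $n \geq N_0$, with probability at least $0.9$ one has $c_1 n \leq |A| \leq c_2 n$.
   Context: $\mathbb{F}_p$ denotes the field with $p$ elements; integers $x,y$ are reduced mod $p$ in the defining congruence of $A$. -}

module Defs where

open import Data.Nat using (ℕ; _+_; _*_; _^_; _≤_; NonZero; ∣_-_∣)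
open import Data.Nat.Properties using (_≟_)
open import Data.Nat.DivMod using (_%_)
open import Data.List using (List; upTo; concatMap; map; filter; length; cartesianProduct)
open import Data.Product using (_×_; _,_)
open import Relation.Nullary using (¬_; ¬?)
open import Relation.Unary using (Decidable)
open import Relation.Binary.PropositionalEquality using (_≡_)

-- Elements of F_p are represented by 0,…,p-1 (as natural numbers);
-- equality in F_p is equality of residues mod p.

Tuple5 : Set
Tuple5 = ℕ × ℕ × ℕ × ℕ × ℕ

tuples : ℕ → List Tuple5
tuples p = concatMap (λ a → concatMap (λ b → concatMap (λ c → concatMap (λ d →
             map (λ e → a , b , c , d , e) r) r) r) r) r
  where r = upTo p

Ω : (p : ℕ) → .{{NonZero p}} → List Tuple5
Ω p = filter (λ { (a , b , c , d , e) → ¬? ((a * d) % p ≟ (b * c) % p) }) (tuples p)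

sizeA : (p : ℕ) → .{{NonZero p}} → ℕ → Tuple5 → ℕ
sizeA p n (a , b , c , d , e) =
  length (filter (λ { (x , y) → ((a * x + b * y) ^ 2) % p ≟ (c * x + d * y + e) % p })
                 (cartesianProduct (upTo n) (upTo n)))

WithProb≥9/10 : (p : ℕ) → .{{NonZero p}} → {P : Tuple5 → Set} → Decidable P → Set
WithProb≥9/10 p P? = 9 * length (Ω p) ≤ 10 * length (filter P? (Ω p))

{-# OPTIONS --safe #-}
-- Second moment method. Write T = |Ω| and X = |A|. For a point (x , y) and fixed a, b, c, d
-- exactly one e ∈ 𝔽ₚ puts (x , y) into A, so p · ∑_Ω X = n² T. For two distinct points of
-- {0,…,n-1}² ⊆ 𝔽ₚ², fixing a, b and one of c, d leaves two congruences describing lines of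
-- distinct slopes in the other coefficient and e; so both points lie in A for at most p³
-- tuples, and p · ∑_Ω X² ≤ n² T + n⁴ p⁴. The singular tuples (a d ≡ b c) number at most 2 p⁴,
-- so T ≥ p⁵ / 2 and ∑_Ω (X p - n²)² = p² ∑_Ω X² - n⁴ T ≤ p n² T + n⁴ (p⁵ - T) ≤ 10 n p² T
-- when 4 n < p. Chebyshev's inequality then gives (X p - n²)² ≤ 100 n p² with probability
-- at least 9/10, and as p < 8 n this forces n/16 ≤ X ≤ 2 n once n ≥ 25600.
module Submission where

open import Defs
open import Data.Nat
open import Data.Nat.Properties
open import Data.Nat.DivMod using (_%_; _/_; m≡m%n+[m/n]*n; m%n≤n; m%n<n; m%n%n≡m%n; m*n%n≡0; %-distribˡ-+; m<n⇒m%n≡m)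
open import Data.Nat.Divisibility using (m%n≡0⇒n∣m; n∣m⇒m%n≡0)
open import Data.Nat.Primality using (Prime; euclidsLemma)
open import Data.Nat.Tactic.RingSolver using (solve-∀)
open import Data.List using (List; []; _∷_; _++_; map; concatMap; filter; length; upTo; cartesianProduct)
open import Data.List.Properties using (length-upTo)
open import Data.List.Membership.Propositional using (_∈_)
open import Data.List.Membership.Propositional.Properties using (∈-upTo⁺; ∈-upTo⁻; ∈-cartesianProduct⁻)
open import Data.List.Relation.Unary.Any using (here; there)
import Data.List.Relation.Unary.All as All
open import Data.List.Relation.Unary.Unique.Propositional using (Unique; []; _∷_)
open import Data.List.Relation.Unary.Unique.Propositional.Properties using (upTo⁺; cartesianProduct⁺)
open import Data.Product using (Σ; _×_; _,_; ∃)
open import Data.Product.Properties using (≡-dec)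
open import Data.Sum using (_⊎_; inj₁; inj₂)
open import Function using (_∘_)
open import Relation.Nullary using (Dec; yes; no; ¬?; contradiction; _×-dec_)
open import Relation.Unary using (Decidable)
open import Relation.Binary.Definitions using (DecidableEquality)
open import Relation.Binary.PropositionalEquality
import Algebra.Properties.CommutativeSemigroup as CommutativeSemigroupProperties
open CommutativeSemigroupProperties +-commutativeSemigroup using (interchange; xy∙z≈xz∙y; xy∙z≈y∙xz; x∙yz≈xz∙y)
module *-Props = CommutativeSemigroupProperties *-commutativeSemigroup

private variable
  A B P Q : Set

-- Indicator sums over lists

𝟙 : Dec P → ℕ
𝟙 (yes _) = 1
𝟙 (no _)  = 0

𝟙≤1 : (d : Dec P) → 𝟙 d ≤ 1
𝟙≤1 (yes _) = ≤-refl
𝟙≤1 (no _)  = z≤n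

𝟙≡1 : (d : Dec P) → P → 𝟙 d ≡ 1
𝟙≡1 (yes _) _ = refl
𝟙≡1 (no ¬p) p = contradiction p ¬p

𝟙>0⇒ : (d : Dec P) → 0 < 𝟙 d → P
𝟙>0⇒ (yes p) _ = p

𝟙*𝟙≡𝟙 : (d : Dec P) → 𝟙 d * 𝟙 d ≡ 𝟙 d
𝟙*𝟙≡𝟙 (yes _) = refl
𝟙*𝟙≡𝟙 (no _)  = refl

𝟙*𝟙≤𝟙 : (d : Dec P) (e : Dec Q) → 𝟙 d * 𝟙 e ≤ 𝟙 d
𝟙*𝟙≤𝟙 (yes _) e = ≤-trans (≤-reflexive (+-identityʳ (𝟙 e))) (𝟙≤1 e)
𝟙*𝟙≤𝟙 (no _)  _ = z≤n

𝟙*𝟙>0⇒ : (d : Dec P) (e : Dec Q) → 0 < 𝟙 d * 𝟙 e → P × Q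
𝟙*𝟙>0⇒ (yes p) (yes q) _ = p , q

𝟙-mono : (P → Q) → (d : Dec P) (e : Dec Q) → 𝟙 d ≤ 𝟙 e
𝟙-mono _   (no _)  _       = z≤n
𝟙-mono _   (yes _) (yes _) = ≤-refl
𝟙-mono P⇒Q (yes p) (no ¬q) = contradiction (P⇒Q p) ¬q

∑ : List A → (A → ℕ) → ℕ
∑ []       f = 0
∑ (x ∷ xs) f = f x + ∑ xs f

infix 5 ∑
syntax ∑ xs (λ x → e) = ∑[ x ∈ xs ] e

module _ {f g : A → ℕ} where

  ∑-cong : (∀ x → f x ≡ g x) → ∀ xs → ∑ xs f ≡ ∑ xs g
  ∑-cong f≡g []       = refl
  ∑-cong f≡g (x ∷ xs) = cong₂ _+_ (f≡g x) (∑-cong f≡g xs)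

  ∑-mono : (∀ x → f x ≤ g x) → ∀ xs → ∑ xs f ≤ ∑ xs g
  ∑-mono f≤g []       = z≤n
  ∑-mono f≤g (x ∷ xs) = +-mono-≤ (f≤g x) (∑-mono f≤g xs)

  ∑-mono-∈ : ∀ {xs} → (∀ {x} → x ∈ xs → f x ≤ g x) → ∑ xs f ≤ ∑ xs g
  ∑-mono-∈ {[]}     f≤g = z≤n
  ∑-mono-∈ {x ∷ xs} f≤g = +-mono-≤ (f≤g (here refl)) (∑-mono-∈ (f≤g ∘ there))

  ∑-distrib-+ : ∀ xs → ∑[ x ∈ xs ] (f x + g x) ≡ ∑ xs f + ∑ xs g
  ∑-distrib-+ []       = refl
  ∑-distrib-+ (x ∷ xs) = trans (cong (f x + g x +_) (∑-distrib-+ xs))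
                               (interchange (f x) (g x) (∑ xs f) (∑ xs g))

*-distribˡ-∑ : ∀ k (f : A → ℕ) xs → k * ∑ xs f ≡ ∑[ x ∈ xs ] k * f x
*-distribˡ-∑ k f []       = *-zeroʳ k
*-distribˡ-∑ k f (x ∷ xs) = trans (*-distribˡ-+ k (f x) (∑ xs f)) (cong (k * f x +_) (*-distribˡ-∑ k f xs))

∑-const : ∀ k (xs : List A) → ∑[ _ ∈ xs ] k ≡ length xs * k
∑-const k []       = refl
∑-const k (x ∷ xs) = cong (k +_) (∑-const k xs)

∑1≡length : ∀ (xs : List A) → ∑[ _ ∈ xs ] 1 ≡ length xs
∑1≡length xs = trans (∑-const 1 xs) (*-identityʳ (length xs))

∑-upTo-const : ∀ k m → ∑[ _ ∈ upTo m ] k ≡ m * k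
∑-upTo-const k m = trans (∑-const k (upTo m)) (cong (_* k) (length-upTo m))

∑-++ : (f : A → ℕ) → ∀ xs ys → ∑ (xs ++ ys) f ≡ ∑ xs f + ∑ ys f
∑-++ f []       ys = refl
∑-++ f (x ∷ xs) ys = trans (cong (f x +_) (∑-++ f xs ys)) (sym (+-assoc (f x) _ _))

∑-map : (f : B → ℕ) (g : A → B) → ∀ xs → ∑ (map g xs) f ≡ ∑[ x ∈ xs ] f (g x)
∑-map f g []       = refl
∑-map f g (x ∷ xs) = cong (f (g x) +_) (∑-map f g xs)

∑-concatMap : (f : B → ℕ) (g : A → List B) → ∀ xs → ∑ (concatMap g xs) f ≡ ∑[ x ∈ xs ] ∑ (g x) f
∑-concatMap f g []       = refl
∑-concatMap f g (x ∷ xs) = trans (∑-++ f (g x) (concatMap g xs)) (cong (∑ (g x) f +_) (∑-concatMap f g xs))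

∑-cartesianProduct : (f : A × B → ℕ) → ∀ xs ys → ∑ (cartesianProduct xs ys) f ≡ ∑[ x ∈ xs ] ∑[ y ∈ ys ] f (x , y)
∑-cartesianProduct f []       ys = refl
∑-cartesianProduct f (x ∷ xs) ys = trans (∑-++ f (map (x ,_) ys) (cartesianProduct xs ys))
  (cong₂ _+_ (∑-map f (x ,_) ys) (∑-cartesianProduct f xs ys))

∑-comm : (f : A → B → ℕ) → ∀ xs ys → ∑[ x ∈ xs ] ∑[ y ∈ ys ] f x y ≡ ∑[ y ∈ ys ] ∑[ x ∈ xs ] f x y
∑-comm f []       ys = sym (trans (∑-const 0 ys) (*-zeroʳ (length ys)))
∑-comm f (x ∷ xs) ys = trans (cong (∑ ys (f x) +_) (∑-comm f xs ys))
                             (sym (∑-distrib-+ ys))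

∑*∑ : (f : A → ℕ) (g : B → ℕ) → ∀ xs ys → ∑ xs f * ∑ ys g ≡ ∑[ x ∈ xs ] ∑[ y ∈ ys ] f x * g y
∑*∑ f g []       ys = refl
∑*∑ f g (x ∷ xs) ys = trans (*-distribʳ-+ (∑ ys g) (f x) (∑ xs f))
  (cong₂ _+_ (*-distribˡ-∑ (f x) g ys) (∑*∑ f g xs ys))

module _ {P : A → Set} (P? : Decidable P) where

  ∑-filter : (f : A → ℕ) → ∀ xs → ∑ (filter P? xs) f ≡ ∑[ x ∈ xs ] 𝟙 (P? x) * f x
  ∑-filter f []       = refl
  ∑-filter f (x ∷ xs) with P? x
  ... | yes _ = cong₂ _+_ (sym (+-identityʳ (f x))) (∑-filter f xs)
  ... | no _  = ∑-filter f xs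

  length-filter≡∑𝟙 : ∀ xs → length (filter P? xs) ≡ ∑[ x ∈ xs ] 𝟙 (P? x)
  length-filter≡∑𝟙 []       = refl
  length-filter≡∑𝟙 (x ∷ xs) with P? x
  ... | yes _ = cong suc (length-filter≡∑𝟙 xs)
  ... | no _  = length-filter≡∑𝟙 xs

  ∑-filter-≤ : (f : A → ℕ) → ∀ xs → ∑ (filter P? xs) f ≤ ∑ xs f
  ∑-filter-≤ f xs = ≤-trans (≤-reflexive (∑-filter f xs))
    (∑-mono (λ x → ≤-trans (*-monoˡ-≤ (f x) (𝟙≤1 (P? x))) (≤-reflexive (*-identityˡ (f x)))) xs)

  length-filter+length-filter¬ : ∀ xs → length (filter P? xs) + length (filter (λ x → ¬? (P? x)) xs) ≡ length xs
  length-filter+length-filter¬ []       = refl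
  length-filter+length-filter¬ (x ∷ xs) with P? x
  ... | yes _ = cong suc (length-filter+length-filter¬ xs)
  ... | no _  = trans (+-suc _ _) (cong suc (length-filter+length-filter¬ xs))

length-filter-mono : {P Q : A → Set} (P? : Decidable P) (Q? : Decidable Q) → (∀ x → P x → Q x) →
                     ∀ xs → length (filter P? xs) ≤ length (filter Q? xs)
length-filter-mono P? Q? P⇒Q xs = subst₂ _≤_ (sym (length-filter≡∑𝟙 P? xs)) (sym (length-filter≡∑𝟙 Q? xs))
  (∑-mono (λ x → 𝟙-mono (P⇒Q x) (P? x) (Q? x)) xs)

module _ {f : A → ℕ} where

  term≤∑ : ∀ {x xs} → x ∈ xs → f x ≤ ∑ xs f
  term≤∑ {xs = y ∷ xs} (here refl) = m≤m+n (f y) (∑ xs f)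
  term≤∑ {xs = y ∷ xs} (there x∈xs) = ≤-trans (term≤∑ x∈xs) (m≤n+m (∑ xs f) (f y))

  ∑>0⇒∃ : ∀ xs → 0 < ∑ xs f → ∃ λ x → x ∈ xs × 0 < f x
  ∑>0⇒∃ (x ∷ xs) ∑>0 with f x in fx≡
  ... | suc _ = x , here refl , subst (0 <_) (sym fx≡) z<s
  ... | zero with y , y∈xs , fy>0 ← ∑>0⇒∃ xs ∑>0 = y , there y∈xs , fy>0

  ∑≤-singleSupport : ∀ {K xs} → Unique xs → (∀ {x} → x ∈ xs → f x ≤ K) →
                     (∀ {x y} → x ∈ xs → y ∈ xs → 0 < f x → 0 < f y → x ≡ y) →
                     ∑ xs f ≤ K
  ∑≤-singleSupport []             _   _    = z≤n
  ∑≤-singleSupport {K} {x ∷ xs} (x∉xs ∷ u) f≤K same with f x in fx≡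
  ... | zero  = ∑≤-singleSupport u (f≤K ∘ there) (λ x∈ y∈ → same (there x∈) (there y∈))
  ... | suc k = begin
    suc k + ∑ xs f          ≤⟨ +-monoʳ-≤ (suc k) (∑-mono-∈ {g = λ _ → 0} vanish) ⟩
    suc k + (∑[ _ ∈ xs ] 0) ≡⟨ cong (suc k +_) (trans (∑-const 0 xs) (*-zeroʳ (length xs))) ⟩
    suc k + 0               ≡⟨ trans (+-identityʳ (suc k)) (sym fx≡) ⟩
    f x                     ≤⟨ f≤K (here refl) ⟩
    K                       ∎
    where
    open ≤-Reasoning
    vanish : ∀ {y} → y ∈ xs → f y ≤ 0
    vanish {y} y∈xs with f y in fy≡
    ... | zero  = z≤n
    ... | suc _ = contradiction
      (same (here refl) (there y∈xs) (subst (0 <_) (sym fx≡) z<s) (subst (0 <_) (sym fy≡) z<s))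
      (All.lookup x∉xs y∈xs)

∑𝟙≟≤1 : (_≟_ : DecidableEquality A) → ∀ {xs} → Unique xs → ∀ z → ∑[ x ∈ xs ] 𝟙 (z ≟ x) ≤ 1
∑𝟙≟≤1 _≟_ u z = ∑≤-singleSupport u (λ {x} _ → 𝟙≤1 (z ≟ x))
  (λ {x} {y} _ _ 0<𝟙x 0<𝟙y → trans (sym (𝟙>0⇒ (z ≟ x) 0<𝟙x)) (𝟙>0⇒ (z ≟ y) 0<𝟙y))

markov : (f : A → ℕ) (K : ℕ) → ∀ xs → K * length (filter (λ x → ¬? (f x ≤? K)) xs) ≤ ∑ xs f
markov f K xs = begin
  K * length (filter (λ x → ¬? (f x ≤? K)) xs)  ≡⟨ cong (K *_) (length-filter≡∑𝟙 (λ x → ¬? (f x ≤? K)) xs) ⟩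
  K * (∑[ x ∈ xs ] 𝟙 (¬? (f x ≤? K)))          ≡⟨ *-distribˡ-∑ K (λ x → 𝟙 (¬? (f x ≤? K))) xs ⟩
  ∑[ x ∈ xs ] K * 𝟙 (¬? (f x ≤? K))            ≤⟨ ∑-mono (λ x → K*𝟙[m≰K]≤m (f x ≤? K)) xs ⟩
  ∑ xs f                                         ∎
  where
  open ≤-Reasoning
  K*𝟙[m≰K]≤m : ∀ {m} (m≤?K : Dec (m ≤ K)) → K * 𝟙 (¬? m≤?K) ≤ m
  K*𝟙[m≰K]≤m (yes _)   = ≤-trans (≤-reflexive (*-zeroʳ K)) z≤n
  K*𝟙[m≰K]≤m (no m≰K) = ≤-trans (≤-reflexive (*-identityʳ K)) (<⇒≤ (≰⇒> m≰K))

markov-9/10 : (f : A → ℕ) (K : ℕ) .{{_ : NonZero K}} → ∀ xs → 10 * ∑ xs f ≤ K * length xs →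
              9 * length xs ≤ 10 * length (filter (λ x → f x ≤? K) xs)
markov-9/10 f K xs mean≤ = +-cancelʳ-≤ (10 * bad) (9 * length xs) (10 * good) (begin
  9 * length xs + 10 * bad    ≤⟨ +-monoʳ-≤ (9 * length xs) 10bad≤ ⟩
  9 * length xs + length xs   ≡⟨ +-comm (9 * length xs) (length xs) ⟩
  10 * length xs              ≡⟨ cong (10 *_) (sym (length-filter+length-filter¬ (λ x → f x ≤? K) xs)) ⟩
  10 * (good + bad)           ≡⟨ *-distribˡ-+ 10 good bad ⟩
  10 * good + 10 * bad        ∎)
  where
  open ≤-Reasoning
  good = length (filter (λ x → f x ≤? K) xs)
  bad  = length (filter (λ x → ¬? (f x ≤? K)) xs)
  10bad≤ : 10 * bad ≤ length xs
  10bad≤ = *-cancelˡ-≤ K (begin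
    K * (10 * bad)  ≡⟨ *-Props.x∙yz≈y∙xz K 10 bad ⟩
    10 * (K * bad)  ≤⟨ *-monoʳ-≤ 10 (markov f K xs) ⟩
    10 * ∑ xs f     ≤⟨ mean≤ ⟩
    K * length xs   ∎)

∣m-n∣²+2mn≡m²+n² : ∀ m n → ∣ m - n ∣ ^ 2 + 2 * m * n ≡ m * m + n * n
∣m-n∣²+2mn≡m²+n² m n with ≤-total m n
... | inj₁ m≤n with k , refl ← m≤n⇒∃[o]m+o≡n m≤n =
  trans (cong (λ d → d ^ 2 + 2 * m * (m + k)) (∣m-m+n∣≡n m k)) (expand m k)
  where
  -- The ring solver does not know _^_; k ^ 2 unfolds to k * (k * 1).
  expand : ∀ m k → k * (k * 1) + 2 * m * (m + k) ≡ m * m + (m + k) * (m + k)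
  expand = solve-∀
... | inj₂ n≤m with k , refl ← m≤n⇒∃[o]m+o≡n n≤m =
  trans (cong (λ d → d ^ 2 + 2 * (n + k) * n) (trans (∣-∣-comm (n + k) n) (∣m-m+n∣≡n n k))) (expand n k)
  where
  expand : ∀ n k → k * (k * 1) + 2 * (n + k) * n ≡ (n + k) * (n + k) + n * n
  expand = solve-∀

∑∣f*p-c∣² : (f : A → ℕ) (p c : ℕ) → ∀ xs →
  (∑[ x ∈ xs ] ∣ f x * p - c ∣ ^ 2) + 2 * (p * c) * ∑ xs f ≡ p * p * (∑[ x ∈ xs ] f x * f x) + c * c * length xs
∑∣f*p-c∣² f p c xs = begin
  (∑[ x ∈ xs ] ∣ f x * p - c ∣ ^ 2) + 2 * (p * c) * ∑ xs f
    ≡⟨ cong ((∑[ x ∈ xs ] ∣ f x * p - c ∣ ^ 2) +_) (*-distribˡ-∑ (2 * (p * c)) f xs) ⟩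
  (∑[ x ∈ xs ] ∣ f x * p - c ∣ ^ 2) + (∑[ x ∈ xs ] 2 * (p * c) * f x)
    ≡⟨ ∑-distrib-+ xs ⟨
  ∑[ x ∈ xs ] (∣ f x * p - c ∣ ^ 2 + 2 * (p * c) * f x)
    ≡⟨ ∑-cong pointwise xs ⟩
  ∑[ x ∈ xs ] (p * p * (f x * f x) + c * c)
    ≡⟨ ∑-distrib-+ xs ⟩
  (∑[ x ∈ xs ] p * p * (f x * f x)) + (∑[ _ ∈ xs ] c * c)
    ≡⟨ cong₂ _+_ (*-distribˡ-∑ (p * p) (λ x → f x * f x) xs) (sym (trans (∑-const (c * c) xs) (*-comm (length xs) (c * c)))) ⟨
  p * p * (∑[ x ∈ xs ] f x * f x) + c * c * length xs
    ∎
  where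
  open ≡-Reasoning
  pointwise : ∀ x → ∣ f x * p - c ∣ ^ 2 + 2 * (p * c) * f x ≡ p * p * (f x * f x) + c * c
  pointwise x = trans (cong (∣ f x * p - c ∣ ^ 2 +_) (regroup (f x) p c))
    (trans (∣m-n∣²+2mn≡m²+n² (f x * p) c) (regroup′ (f x) p c))
    where
    regroup : ∀ y p c → 2 * (p * c) * y ≡ 2 * (y * p) * c
    regroup = solve-∀
    regroup′ : ∀ y p c → y * p * (y * p) + c * c ≡ p * p * (y * y) + c * c
    regroup′ = solve-∀

module Congruence (p : ℕ) .{{_ : NonZero p}} where

  infix 4 _≈_ _≈?_

  _≈_ : ℕ → ℕ → Set
  m ≈ n = m % p ≡ n % p

  _≈?_ : ∀ m n → Dec (m ≈ n)
  m ≈? n = m % p ≟ n % p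

  ≈-+ : ∀ {a b c d} → a ≈ b → c ≈ d → a + c ≈ b + d
  ≈-+ {a} {b} {c} {d} a≈b c≈d = begin
    (a + c) % p              ≡⟨ %-distribˡ-+ a c p ⟩
    (a % p + c % p) % p      ≡⟨ cong₂ (λ x y → (x + y) % p) a≈b c≈d ⟩
    (b % p + d % p) % p      ≡⟨ %-distribˡ-+ b d p ⟨
    (b + d) % p              ∎
    where open ≡-Reasoning

  ≈⇒≡ : ∀ {m n} → m < p → n < p → m ≈ n → m ≡ n
  ≈⇒≡ m<p n<p m≈n = trans (sym (m<n⇒m%n≡m m<p)) (trans m≈n (m<n⇒m%n≡m n<p))

  m+[p∸m%p]≈0 : ∀ m → m + (p ∸ m % p) ≈ 0
  m+[p∸m%p]≈0 m = trans (cong (_% p) m+[p∸m%p]≡[1+m/p]*p) (trans (m*n%n≡0 (suc (m / p)) p) (sym (m*n%n≡0 0 p)))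
    where
    open ≡-Reasoning
    m+[p∸m%p]≡[1+m/p]*p : m + (p ∸ m % p) ≡ suc (m / p) * p
    m+[p∸m%p]≡[1+m/p]*p = begin
      m + (p ∸ m % p)                      ≡⟨ cong (_+ (p ∸ m % p)) (m≡m%n+[m/n]*n m p) ⟩
      m % p + m / p * p + (p ∸ m % p)      ≡⟨ xy∙z≈xz∙y (m % p) (m / p * p) (p ∸ m % p) ⟩
      m % p + (p ∸ m % p) + m / p * p      ≡⟨ cong (_+ m / p * p) (m+[n∸m]≡n (m%n≤n m p)) ⟩
      p + m / p * p                        ∎

  +-cancelˡ-≈ : ∀ k {a b} → k + a ≈ k + b → a ≈ b
  +-cancelˡ-≈ k {a} {b} k+a≈k+b = begin
    a % p                     ≡⟨ ≈-+ (m+[p∸m%p]≈0 k) refl ⟨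
    (k + k′ + a) % p          ≡⟨ cong (_% p) (xy∙z≈y∙xz k k′ a) ⟩
    (k′ + (k + a)) % p        ≡⟨ ≈-+ {k′} refl k+a≈k+b ⟩
    (k′ + (k + b)) % p        ≡⟨ cong (_% p) (xy∙z≈y∙xz k k′ b) ⟨
    (k + k′ + b) % p          ≡⟨ ≈-+ (m+[p∸m%p]≈0 k) refl ⟩
    b % p                     ∎
    where
    open ≡-Reasoning
    k′ = p ∸ k % p

  ≈-exchange : ∀ {a b c d e₁ e₂} → a + e₁ ≈ b + e₂ → c + e₁ ≈ d + e₂ → a + d ≈ c + b
  ≈-exchange {a} {b} {c} {d} {e₁} {e₂} h₁ h₂ = +-cancelˡ-≈ (e₁ + e₂) (begin
    (e₁ + e₂ + (a + d)) % p       ≡⟨ cong (_% p) (shuffle₁ a d e₁ e₂) ⟩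
    (a + e₁ + (d + e₂)) % p       ≡⟨ ≈-+ h₁ (sym h₂) ⟩
    (b + e₂ + (c + e₁)) % p       ≡⟨ cong (_% p) (shuffle₂ b c e₁ e₂) ⟩
    (e₁ + e₂ + (c + b)) % p       ∎)
    where
    open ≡-Reasoning
    shuffle₁ : ∀ a d e₁ e₂ → e₁ + e₂ + (a + d) ≡ a + e₁ + (d + e₂)
    shuffle₁ = solve-∀
    shuffle₂ : ∀ b c e₁ e₂ → b + e₂ + (c + e₁) ≡ e₁ + e₂ + (c + b)
    shuffle₂ = solve-∀

  _⊖_ : ℕ → ℕ → ℕ
  s ⊖ k = (s + (p ∸ k % p)) % p

  ⊖<p : ∀ s k → s ⊖ k < p
  ⊖<p s k = m%n<n (s + (p ∸ k % p)) p

  +⊖≈ : ∀ s k → k + s ⊖ k ≈ s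
  +⊖≈ s k = begin
    (k + (s + k′) % p) % p    ≡⟨ ≈-+ {k} refl (m%n%n≡m%n (s + k′) p) ⟩
    (k + (s + k′)) % p        ≡⟨ cong (_% p) (x∙yz≈xz∙y k s k′) ⟩
    (k + k′ + s) % p          ≡⟨ ≈-+ (m+[p∸m%p]≈0 k) refl ⟩
    s % p                     ∎
    where
    open ≡-Reasoning
    k′ = p ∸ k % p

  ∑𝟙[s≈k+e]≡1 : ∀ s k → ∑[ e ∈ upTo p ] 𝟙 (s ≈? k + e) ≡ 1
  ∑𝟙[s≈k+e]≡1 s k = ≤-antisym
    (∑≤-singleSupport (upTo⁺ p) (λ {e} _ → 𝟙≤1 (s ≈? k + e)) unique)
    (begin
      1                              ≡⟨ 𝟙≡1 (s ≈? k + s ⊖ k) (sym (+⊖≈ s k)) ⟨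
      𝟙 (s ≈? k + s ⊖ k)             ≤⟨ term≤∑ (∈-upTo⁺ (⊖<p s k)) ⟩
      ∑[ e ∈ upTo p ] 𝟙 (s ≈? k + e) ∎)
    where
    open ≤-Reasoning
    unique : ∀ {e₁ e₂} → e₁ ∈ upTo p → e₂ ∈ upTo p → 0 < 𝟙 (s ≈? k + e₁) → 0 < 𝟙 (s ≈? k + e₂) → e₁ ≡ e₂
    unique {e₁} {e₂} e₁∈ e₂∈ sol₁ sol₂ = ≈⇒≡ (∈-upTo⁻ e₁∈) (∈-upTo⁻ e₂∈)
      (+-cancelˡ-≈ k (trans (sym (𝟙>0⇒ (s ≈? k + e₁) sol₁)) (𝟙>0⇒ (s ≈? k + e₂) sol₂)))

  module _ (p-prime : Prime p) where

    *≈0⇒ : ∀ {m n} → m < p → n < p → m * n ≈ 0 → m ≡ 0 ⊎ n ≡ 0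
    *≈0⇒ {m} {n} m<p n<p m*n≈0 with euclidsLemma m n p-prime (m%n≡0⇒n∣m (m * n) p (trans m*n≈0 (m*n%n≡0 0 p)))
    ... | inj₁ p∣m = inj₁ (trans (sym (m<n⇒m%n≡m m<p)) (n∣m⇒m%n≡0 m p p∣m))
    ... | inj₂ p∣n = inj₂ (trans (sym (m<n⇒m%n≡m n<p)) (n∣m⇒m%n≡0 n p p∣n))

    private
      ≈-flip : ∀ a b c d → a + b ≈ c + d → d + c ≈ b + a
      ≈-flip a b c d h = trans (cong (_% p) (+-comm d c)) (trans (sym h) (cong (_% p) (+-comm a b)))

      -- With z₁ = z + δ and w = v + ε the two sides differ by δ * ε, so p ∣ δ * ε.
      *-cross-cancel-≤ : ∀ {z₁ z₂ w w′} → z₂ ≤ z₁ → w′ ≤ w → z₁ < p → w < p → w ≢ w′ →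
                         z₁ * w + z₂ * w′ ≈ z₁ * w′ + z₂ * w → z₁ ≡ z₂
      *-cross-cancel-≤ {z₂ = z} {w′ = v} z≤ v≤ z+δ<p v+ε<p v+ε≢v eq
        with δ , refl ← m≤n⇒∃[o]m+o≡n z≤ | ε , refl ← m≤n⇒∃[o]m+o≡n v≤ = trans (cong (z +_) δ≡0) (+-identityʳ z)
        where
        R = (z + δ) * v + z * (v + ε)
        expand : ∀ z δ v ε → (z + δ) * (v + ε) + z * v ≡ (z + δ) * v + z * (v + ε) + δ * ε
        expand = solve-∀
        δε≈0 : δ * ε ≈ 0
        δε≈0 = +-cancelˡ-≈ R (trans (cong (_% p) (sym (expand z δ v ε))) (trans eq (cong (_% p) (sym (+-identityʳ R)))))
        δ≡0 : δ ≡ 0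
        δ≡0 with *≈0⇒ (≤-<-trans (m≤n+m δ z) z+δ<p) (≤-<-trans (m≤n+m ε v) v+ε<p) δε≈0
        ... | inj₁ δ≡0 = δ≡0
        ... | inj₂ refl = contradiction (+-identityʳ v) v+ε≢v

    *-cross-cancel : ∀ {z₁ z₂ w w′} → z₁ < p → z₂ < p → w < p → w′ < p → w ≢ w′ →
                     z₁ * w + z₂ * w′ ≈ z₁ * w′ + z₂ * w → z₁ ≡ z₂
    *-cross-cancel {z₁} {z₂} {w} {w′} z₁<p z₂<p w<p w′<p w≢w′ eq with ≤-total _ _ | ≤-total _ _
    ... | inj₁ z₂≤z₁ | inj₁ w′≤w = *-cross-cancel-≤ z₂≤z₁ w′≤w z₁<p w<p w≢w′ eq
    ... | inj₁ z₂≤z₁ | inj₂ w≤w′ = *-cross-cancel-≤ z₂≤z₁ w≤w′ z₁<p w′<p (w≢w′ ∘ sym) (sym eq)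
    ... | inj₂ z₁≤z₂ | inj₁ w′≤w = sym (*-cross-cancel-≤ z₁≤z₂ w′≤w z₂<p w<p w≢w′ (≈-flip (z₁ * w) (z₂ * w′) (z₁ * w′) (z₂ * w) eq))
    ... | inj₂ z₁≤z₂ | inj₂ w≤w′ = sym (*-cross-cancel-≤ z₁≤z₂ w≤w′ z₂<p w′<p (w≢w′ ∘ sym) (≈-flip (z₁ * w′) (z₂ * w) (z₁ * w) (z₂ * w′) (sym eq)))

    *-cancelˡ-≈ : ∀ {a d₁ d₂} → a < p → a ≢ 0 → d₁ < p → d₂ < p → a * d₁ ≈ a * d₂ → d₁ ≡ d₂
    *-cancelˡ-≈ {a} {d₁} {d₂} a<p a≢0 d₁<p d₂<p ad₁≈ad₂ = *-cross-cancel d₁<p d₂<p a<p (>-nonZero⁻¹ p) a≢0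
      (trans (cong (_% p) (trans (cong₂ _+_ (*-comm d₁ a) (*-zeroʳ d₂)) (+-identityʳ (a * d₁))))
        (trans ad₁≈ad₂ (cong (_% p) (sym (cong₂ _+_ (*-zeroʳ d₁) (*-comm d₂ a))))))

    -- Each congruence cuts out a line of slope w resp. w′ in the (v , e)-plane 𝔽ₚ², and lines
    -- of distinct slopes meet at most once.
    lines-meet-once : ∀ s s′ u u′ {w w′} → w < p → w′ < p → w ≢ w′ →
      ∑[ v ∈ upTo p ] ∑[ e ∈ upTo p ] 𝟙 (s ≈? u + v * w + e) * 𝟙 (s′ ≈? u′ + v * w′ + e) ≤ 1
    lines-meet-once s s′ u u′ {w} {w′} w<p w′<p w≢w′ = ∑≤-singleSupport (upTo⁺ p) (λ {v} _ → one-e v) same-v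
      where
      one-e : ∀ v → ∑[ e ∈ upTo p ] 𝟙 (s ≈? u + v * w + e) * 𝟙 (s′ ≈? u′ + v * w′ + e) ≤ 1
      one-e v = begin
        ∑[ e ∈ upTo p ] 𝟙 (s ≈? u + v * w + e) * 𝟙 (s′ ≈? u′ + v * w′ + e)
          ≤⟨ ∑-mono (λ e → 𝟙*𝟙≤𝟙 (s ≈? u + v * w + e) (s′ ≈? u′ + v * w′ + e)) (upTo p) ⟩
        ∑[ e ∈ upTo p ] 𝟙 (s ≈? u + v * w + e)
          ≡⟨ ∑𝟙[s≈k+e]≡1 s (u + v * w) ⟩
        1 ∎
        where open ≤-Reasoning

      solution : ∀ {v} → 0 < ∑[ e ∈ upTo p ] 𝟙 (s ≈? u + v * w + e) * 𝟙 (s′ ≈? u′ + v * w′ + e) →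
                 ∃ λ e → s ≈ u + v * w + e × s′ ≈ u′ + v * w′ + e
      solution {v} pos with e , _ , pos′ ← ∑>0⇒∃ (upTo p) pos =
        e , 𝟙*𝟙>0⇒ (s ≈? u + v * w + e) (s′ ≈? u′ + v * w′ + e) pos′

      drop-u : ∀ u a b {s e₁ e₂} → s ≈ u + a + e₁ → s ≈ u + b + e₂ → a + e₁ ≈ b + e₂
      drop-u u a b {s} {e₁} {e₂} h₁ h₂ = +-cancelˡ-≈ u
        (trans (cong (_% p) (sym (+-assoc u a e₁))) (trans (sym h₁) (trans h₂ (cong (_% p) (+-assoc u b e₂)))))

      same-v : ∀ {v₁ v₂} → v₁ ∈ upTo p → v₂ ∈ upTo p →
               0 < ∑[ e ∈ upTo p ] 𝟙 (s ≈? u + v₁ * w + e) * 𝟙 (s′ ≈? u′ + v₁ * w′ + e) →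
               0 < ∑[ e ∈ upTo p ] 𝟙 (s ≈? u + v₂ * w + e) * 𝟙 (s′ ≈? u′ + v₂ * w′ + e) → v₁ ≡ v₂
      same-v {v₁} {v₂} v₁∈ v₂∈ pos₁ pos₂
        with e₁ , s≈₁ , s′≈₁ ← solution {v₁} pos₁ | e₂ , s≈₂ , s′≈₂ ← solution {v₂} pos₂ =
        *-cross-cancel (∈-upTo⁻ v₁∈) (∈-upTo⁻ v₂∈) w<p w′<p w≢w′
          (≈-exchange {a = v₁ * w} {v₂ * w} {v₁ * w′} {v₂ * w′} (drop-u u (v₁ * w) (v₂ * w) s≈₁ s≈₂) (drop-u u′ (v₁ * w′) (v₂ * w′) s′≈₁ s′≈₂))

module Moments (p : ℕ) .{{_ : NonZero p}} where

  open Congruence p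

  𝔽ₚ : List ℕ
  𝔽ₚ = upTo p

  ∑⁴ : (ℕ → ℕ → ℕ → ℕ → ℕ) → ℕ
  ∑⁴ f = ∑[ a ∈ 𝔽ₚ ] ∑[ b ∈ 𝔽ₚ ] ∑[ c ∈ 𝔽ₚ ] ∑[ d ∈ 𝔽ₚ ] f a b c d

  ∑⁴-cong : ∀ {f g} → (∀ a b c d → f a b c d ≡ g a b c d) → ∑⁴ f ≡ ∑⁴ g
  ∑⁴-cong f≡g = ∑-cong (λ a → ∑-cong (λ b → ∑-cong (λ c → ∑-cong (f≡g a b c) 𝔽ₚ) 𝔽ₚ) 𝔽ₚ) 𝔽ₚ

  ∑-tuples : (g : Tuple5 → ℕ) → ∑ (tuples p) g ≡ ∑⁴ λ a b c d → ∑[ e ∈ 𝔽ₚ ] g (a , b , c , d , e)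
  ∑-tuples g =
    trans (∑-concatMap g _ 𝔽ₚ) (∑-cong (λ a →
    trans (∑-concatMap g _ 𝔽ₚ) (∑-cong (λ b →
    trans (∑-concatMap g _ 𝔽ₚ) (∑-cong (λ c →
    trans (∑-concatMap g _ 𝔽ₚ) (∑-cong (λ d →
    ∑-map g _ 𝔽ₚ) 𝔽ₚ)) 𝔽ₚ)) 𝔽ₚ)) 𝔽ₚ)

  ∑³-≤ : ∀ {F : ℕ → ℕ → ℕ → ℕ} (k : ℕ → ℕ) → (∀ a b c → a < p → F a b c ≤ k a) →
         ∑[ a ∈ 𝔽ₚ ] ∑[ b ∈ 𝔽ₚ ] ∑[ c ∈ 𝔽ₚ ] F a b c ≤ ∑[ a ∈ 𝔽ₚ ] p * (p * k a)
  ∑³-≤ k F≤k = ∑-mono-∈ (λ {a} a∈𝔽ₚ → ≤-trans (∑-mono (λ b → ∑-mono (λ c → F≤k a b c (∈-upTo⁻ a∈𝔽ₚ)) 𝔽ₚ) 𝔽ₚ)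
    (≤-reflexive (trans (∑-cong (λ _ → ∑-upTo-const (k a) p) 𝔽ₚ) (∑-upTo-const (p * k a) p))))

  Singular : Tuple5 → Set
  Singular (a , b , c , d , e) = a * d ≈ b * c

  singular? : ∀ t → Dec (Singular t)
  singular? (a , b , c , d , e) = a * d ≈? b * c

  𝟙[ad≉bc] : ℕ → ℕ → ℕ → ℕ → ℕ
  𝟙[ad≉bc] a b c d = 𝟙 (¬? (a * d ≈? b * c))

  ∑-Ω : (f : Tuple5 → ℕ) → ∑ (Ω p) f ≡ ∑⁴ λ a b c d → 𝟙[ad≉bc] a b c d * (∑[ e ∈ 𝔽ₚ ] f (a , b , c , d , e))
  ∑-Ω f = trans (∑-filter (λ t → ¬? (singular? t)) f (tuples p))
    (trans (∑-tuples _) (∑⁴-cong (λ a b c d → sym (*-distribˡ-∑ (𝟙[ad≉bc] a b c d) _ 𝔽ₚ))))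

  ∑-Ω-cong-fibres : ∀ {f g : Tuple5 → ℕ} →
    (∀ a b c d → ∑[ e ∈ 𝔽ₚ ] f (a , b , c , d , e) ≡ ∑[ e ∈ 𝔽ₚ ] g (a , b , c , d , e)) →
    ∑ (Ω p) f ≡ ∑ (Ω p) g
  ∑-Ω-cong-fibres {f} {g} fibres = trans (∑-Ω f) (trans (∑⁴-cong (λ a b c d → cong (𝟙[ad≉bc] a b c d *_) (fibres a b c d))) (sym (∑-Ω g)))

  #singular : ℕ
  #singular = length (filter singular? (tuples p))

  length-tuples : length (tuples p) ≡ p ^ 5
  length-tuples = begin
    length (tuples p)                      ≡⟨ ∑1≡length (tuples p) ⟨
    ∑[ _ ∈ tuples p ] 1                    ≡⟨ ∑-tuples (λ _ → 1) ⟩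
    ∑⁴ (λ _ _ _ _ → ∑[ _ ∈ 𝔽ₚ ] 1)         ≡⟨ ∑⁴-cong (λ _ _ _ _ → ∑-upTo-const 1 p) ⟩
    ∑[ a ∈ 𝔽ₚ ] ∑[ b ∈ 𝔽ₚ ] ∑[ c ∈ 𝔽ₚ ] ∑[ d ∈ 𝔽ₚ ] p * 1
      ≡⟨ ∑-cong (λ _ → ∑-cong (λ _ → trans (∑-cong (λ _ → ∑-upTo-const (p * 1) p) 𝔽ₚ) (∑-upTo-const _ p)) 𝔽ₚ) 𝔽ₚ ⟩
    ∑[ a ∈ 𝔽ₚ ] ∑[ b ∈ 𝔽ₚ ] p * (p * (p * 1))
      ≡⟨ trans (∑-cong (λ _ → ∑-upTo-const _ p) 𝔽ₚ) (∑-upTo-const _ p) ⟩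
    p ^ 5                                  ∎
    where open ≡-Reasoning

  |Ω|+#singular≡p⁵ : length (Ω p) + #singular ≡ p ^ 5
  |Ω|+#singular≡p⁵ = trans (+-comm (length (Ω p)) #singular)
    (trans (length-filter+length-filter¬ singular? (tuples p)) length-tuples)

  𝟙A : Tuple5 → ℕ × ℕ → ℕ
  𝟙A (a , b , c , d , e) (x , y) = 𝟙 ((a * x + b * y) ^ 2 ≈? c * x + d * y + e)

  grid : ℕ → List (ℕ × ℕ)
  grid n = cartesianProduct (upTo n) (upTo n)

  sizeA≡∑𝟙A : ∀ n t → sizeA p n t ≡ ∑[ P ∈ grid n ] 𝟙A t P
  sizeA≡∑𝟙A n (a , b , c , d , e) = length-filter≡∑𝟙 _ (grid n)

  p*∑𝟙A≡|Ω| : ∀ P → p * (∑[ t ∈ Ω p ] 𝟙A t P) ≡ length (Ω p)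
  p*∑𝟙A≡|Ω| (x , y) = begin
    p * (∑[ t ∈ Ω p ] 𝟙A t (x , y))  ≡⟨ *-distribˡ-∑ p _ (Ω p) ⟩
    ∑[ t ∈ Ω p ] p * 𝟙A t (x , y)    ≡⟨ ∑-Ω-cong-fibres p-solutions ⟩
    ∑[ t ∈ Ω p ] 1                   ≡⟨ ∑1≡length (Ω p) ⟩
    length (Ω p)                     ∎
    where
    open ≡-Reasoning
    p-solutions : ∀ a b c d → ∑[ e ∈ 𝔽ₚ ] p * 𝟙A (a , b , c , d , e) (x , y) ≡ ∑[ e ∈ 𝔽ₚ ] 1
    p-solutions a b c d = begin
      ∑[ e ∈ 𝔽ₚ ] p * 𝟙A (a , b , c , d , e) (x , y)    ≡⟨ *-distribˡ-∑ p _ 𝔽ₚ ⟨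
      p * (∑[ e ∈ 𝔽ₚ ] 𝟙A (a , b , c , d , e) (x , y))  ≡⟨ cong (p *_) (∑𝟙[s≈k+e]≡1 _ (c * x + d * y)) ⟩
      p * 1                                              ≡⟨ ∑-upTo-const 1 p ⟨
      ∑[ e ∈ 𝔽ₚ ] 1                                      ∎

  _≟²_ : (P Q : ℕ × ℕ) → Dec (P ≡ Q)
  _≟²_ = ≡-dec _≟_ _≟_

  module _ (p-prime : Prime p) where

    ∑𝟙A*𝟙A≤p³ : ∀ {x y x′ y′} → x < p → y < p → x′ < p → y′ < p → (x , y) ≢ (x′ , y′) →
                ∑[ t ∈ Ω p ] 𝟙A t (x , y) * 𝟙A t (x′ , y′) ≤ p ^ 3
    ∑𝟙A*𝟙A≤p³ {x} {y} {x′} {y′} x<p y<p x′<p y′<p P≢Q = begin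
      ∑[ t ∈ Ω p ] H t                                      ≤⟨ ∑-filter-≤ (λ t → ¬? (singular? t)) H (tuples p) ⟩
      ∑[ t ∈ tuples p ] H t                                 ≡⟨ ∑-tuples H ⟩
      ∑⁴ (λ a b c d → ∑[ e ∈ 𝔽ₚ ] H (a , b , c , d , e))    ≤⟨ split (x ≟ x′) (y ≟ y′) ⟩
      ∑[ a ∈ 𝔽ₚ ] p * (p * 1)                               ≡⟨ ∑-upTo-const (p * (p * 1)) p ⟩
      p ^ 3                                                 ∎
      where
      open ≤-Reasoning
      H : Tuple5 → ℕ
      H t = 𝟙A t (x , y) * 𝟙A t (x′ , y′)
      s s′ : ℕ → ℕ → ℕ
      s  a b = (a * x + b * y) ^ 2
      s′ a b = (a * x′ + b * y′) ^ 2
      d-line : y ≢ y′ → ∀ a b c → ∑[ d ∈ 𝔽ₚ ] ∑[ e ∈ 𝔽ₚ ] H (a , b , c , d , e) ≤ 1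
      d-line y≢y′ a b c = lines-meet-once p-prime (s a b) (s′ a b) (c * x) (c * x′) y<p y′<p y≢y′
      c-line : x ≢ x′ → ∀ a b d → ∑[ c ∈ 𝔽ₚ ] ∑[ e ∈ 𝔽ₚ ] H (a , b , c , d , e) ≤ 1
      c-line x≢x′ a b d = begin
        ∑[ c ∈ 𝔽ₚ ] ∑[ e ∈ 𝔽ₚ ] H (a , b , c , d , e)
          ≡⟨ ∑-cong (λ c → ∑-cong (λ e → cong₂ (λ m m′ → 𝟙 (s a b ≈? m + e) * 𝟙 (s′ a b ≈? m′ + e))
                                               (+-comm (c * x) (d * y)) (+-comm (c * x′) (d * y′))) 𝔽ₚ) 𝔽ₚ ⟩
        ∑[ c ∈ 𝔽ₚ ] ∑[ e ∈ 𝔽ₚ ] 𝟙 (s a b ≈? d * y + c * x + e) * 𝟙 (s′ a b ≈? d * y′ + c * x′ + e)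
          ≤⟨ lines-meet-once p-prime (s a b) (s′ a b) (d * y) (d * y′) x<p x′<p x≢x′ ⟩
        1 ∎
      split : Dec (x ≡ x′) → Dec (y ≡ y′) →
              ∑⁴ (λ a b c d → ∑[ e ∈ 𝔽ₚ ] H (a , b , c , d , e)) ≤ ∑[ a ∈ 𝔽ₚ ] p * (p * 1)
      split (yes refl) (yes refl) = contradiction refl P≢Q
      split _ (no y≢y′) = ∑³-≤ (λ _ → 1) (λ a b c _ → d-line y≢y′ a b c)
      split (no x≢x′) _ = begin
        ∑⁴ (λ a b c d → ∑[ e ∈ 𝔽ₚ ] H (a , b , c , d , e))
          ≡⟨ ∑-cong (λ a → ∑-cong (λ b → ∑-comm (λ c d → ∑[ e ∈ 𝔽ₚ ] H (a , b , c , d , e)) 𝔽ₚ 𝔽ₚ) 𝔽ₚ) 𝔽ₚ ⟩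
        ∑[ a ∈ 𝔽ₚ ] ∑[ b ∈ 𝔽ₚ ] ∑[ d ∈ 𝔽ₚ ] ∑[ c ∈ 𝔽ₚ ] ∑[ e ∈ 𝔽ₚ ] H (a , b , c , d , e)
          ≤⟨ ∑³-≤ (λ _ → 1) (λ a b d _ → c-line x≢x′ a b d) ⟩
        ∑[ a ∈ 𝔽ₚ ] p * (p * 1) ∎

    #singular≤2p⁴ : #singular ≤ 2 * p ^ 4
    #singular≤2p⁴ = begin
      #singular                                                 ≡⟨ length-filter≡∑𝟙 singular? (tuples p) ⟩
      ∑[ t ∈ tuples p ] 𝟙 (singular? t)                         ≡⟨ ∑-tuples _ ⟩
      ∑⁴ (λ a b c d → ∑[ e ∈ 𝔽ₚ ] 𝟙 (a * d ≈? b * c))           ≤⟨ ∑³-≤ k fibre ⟩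
      ∑[ a ∈ 𝔽ₚ ] p * (p * k a)                                 ≡⟨ ∑-cong (λ a → expand p (𝟙 (0 ≟ a))) 𝔽ₚ ⟩
      ∑[ a ∈ 𝔽ₚ ] (p * (p * p) + p * (p * (p * p)) * 𝟙 (0 ≟ a))
        ≡⟨ ∑-distrib-+ 𝔽ₚ ⟩
      (∑[ a ∈ 𝔽ₚ ] p * (p * p)) + (∑[ a ∈ 𝔽ₚ ] p * (p * (p * p)) * 𝟙 (0 ≟ a))
        ≡⟨ cong₂ _+_ (∑-upTo-const _ p) (sym (*-distribˡ-∑ (p * (p * (p * p))) (λ a → 𝟙 (0 ≟ a)) 𝔽ₚ)) ⟩
      p * (p * (p * p)) + p * (p * (p * p)) * (∑[ a ∈ 𝔽ₚ ] 𝟙 (0 ≟ a))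
        ≤⟨ +-monoʳ-≤ (p * (p * (p * p))) (*-monoʳ-≤ (p * (p * (p * p))) (∑𝟙≟≤1 _≟_ (upTo⁺ p) 0)) ⟩
      p * (p * (p * p)) + p * (p * (p * p)) * 1                 ≡⟨ double p ⟩
      2 * p ^ 4                                                 ∎
      where
      open ≤-Reasoning
      -- For a ≢ 0 the congruence a d ≡ b c determines d; the row a = 0 is bounded trivially.
      k : ℕ → ℕ
      k a = p + 𝟙 (0 ≟ a) * (p * p)
      expand : ∀ p i → p * (p * (p + i * (p * p))) ≡ p * (p * p) + p * (p * (p * p)) * i
      expand = solve-∀
      double : ∀ p → p * (p * (p * p)) + p * (p * (p * p)) * 1 ≡ 2 * (p * (p * (p * (p * 1))))
      double = solve-∀
      fibre : ∀ a b c → a < p → ∑[ d ∈ 𝔽ₚ ] ∑[ e ∈ 𝔽ₚ ] 𝟙 (a * d ≈? b * c) ≤ k a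
      fibre a b c a<p with 0 ≟ a
      ... | yes refl = begin
        ∑[ d ∈ 𝔽ₚ ] ∑[ e ∈ 𝔽ₚ ] 𝟙 (0 * d ≈? b * c)   ≤⟨ ∑-mono (λ d → ∑-mono (λ _ → 𝟙≤1 (0 * d ≈? b * c)) 𝔽ₚ) 𝔽ₚ ⟩
        ∑[ d ∈ 𝔽ₚ ] ∑[ e ∈ 𝔽ₚ ] 1                     ≡⟨ trans (∑-cong (λ _ → ∑-upTo-const 1 p) 𝔽ₚ) (∑-upTo-const _ p) ⟩
        p * (p * 1)                                   ≡⟨ cong (p *_) (*-identityʳ p) ⟩
        p * p                                         ≤⟨ m≤n+m (p * p) p ⟩
        p + p * p                                     ≡⟨ cong (p +_) (+-identityʳ (p * p)) ⟨
        p + (p * p + 0)                               ∎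
      ... | no 0≢a = begin
        ∑[ d ∈ 𝔽ₚ ] ∑[ e ∈ 𝔽ₚ ] 𝟙 (a * d ≈? b * c)   ≡⟨ ∑-cong (λ d → ∑-upTo-const (𝟙 (a * d ≈? b * c)) p) 𝔽ₚ ⟩
        ∑[ d ∈ 𝔽ₚ ] p * 𝟙 (a * d ≈? b * c)            ≡⟨ *-distribˡ-∑ p _ 𝔽ₚ ⟨
        p * (∑[ d ∈ 𝔽ₚ ] 𝟙 (a * d ≈? b * c))          ≤⟨ *-monoʳ-≤ p (∑≤-singleSupport (upTo⁺ p) (λ {d} _ → 𝟙≤1 (a * d ≈? b * c)) same-d) ⟩
        p * 1                                         ≡⟨ trans (*-identityʳ p) (sym (+-identityʳ p)) ⟩
        p + 0                                         ∎
        where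
        same-d : ∀ {d₁ d₂} → d₁ ∈ 𝔽ₚ → d₂ ∈ 𝔽ₚ → 0 < 𝟙 (a * d₁ ≈? b * c) → 0 < 𝟙 (a * d₂ ≈? b * c) → d₁ ≡ d₂
        same-d {d₁} {d₂} d₁∈ d₂∈ sol₁ sol₂ = *-cancelˡ-≈ p-prime a<p (0≢a ∘ sym) (∈-upTo⁻ d₁∈) (∈-upTo⁻ d₂∈)
          (trans (𝟙>0⇒ (a * d₁ ≈? b * c) sol₁) (sym (𝟙>0⇒ (a * d₂ ≈? b * c) sol₂)))

    p*∑𝟙A*𝟙A≤ : ∀ {x y x′ y′} → x < p → y < p → x′ < p → y′ < p →
      p * (∑[ t ∈ Ω p ] 𝟙A t (x , y) * 𝟙A t (x′ , y′)) ≤ length (Ω p) * 𝟙 ((x , y) ≟² (x′ , y′)) + p ^ 4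
    p*∑𝟙A*𝟙A≤ {x} {y} {x′} {y′} x<p y<p x′<p y′<p with (x , y) ≟² (x′ , y′)
    ... | yes refl = begin
      p * (∑[ t ∈ Ω p ] 𝟙A t (x , y) * 𝟙A t (x , y))  ≡⟨ cong (p *_) (∑-cong (λ t → 𝟙*𝟙≡𝟙 _) (Ω p)) ⟩
      p * (∑[ t ∈ Ω p ] 𝟙A t (x , y))                 ≡⟨ p*∑𝟙A≡|Ω| (x , y) ⟩
      length (Ω p)                                    ≡⟨ *-identityʳ (length (Ω p)) ⟨
      length (Ω p) * 1                                ≤⟨ m≤m+n _ _ ⟩
      length (Ω p) * 1 + p ^ 4                        ∎
      where open ≤-Reasoning
    ... | no P≢Q = ≤-trans (*-monoʳ-≤ p (∑𝟙A*𝟙A≤p³ x<p y<p x′<p y′<p P≢Q)) (m≤n+m _ _)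

  ∑-grid-const : ∀ n k → ∑[ _ ∈ grid n ] k ≡ n * (n * k)
  ∑-grid-const n k = trans (∑-cartesianProduct (λ _ → k) (upTo n) (upTo n))
    (trans (∑-cong (λ _ → ∑-upTo-const k n) (upTo n)) (∑-upTo-const (n * k) n))

  first-moment : ∀ n → p * (∑[ t ∈ Ω p ] sizeA p n t) ≡ n * (n * length (Ω p))
  first-moment n = begin
    p * (∑[ t ∈ Ω p ] sizeA p n t)                  ≡⟨ cong (p *_) (∑-cong (sizeA≡∑𝟙A n) (Ω p)) ⟩
    p * (∑[ t ∈ Ω p ] ∑[ P ∈ grid n ] 𝟙A t P)       ≡⟨ cong (p *_) (∑-comm 𝟙A (Ω p) (grid n)) ⟩
    p * (∑[ P ∈ grid n ] ∑[ t ∈ Ω p ] 𝟙A t P)       ≡⟨ *-distribˡ-∑ p _ (grid n) ⟩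
    ∑[ P ∈ grid n ] p * (∑[ t ∈ Ω p ] 𝟙A t P)       ≡⟨ ∑-cong p*∑𝟙A≡|Ω| (grid n) ⟩
    ∑[ P ∈ grid n ] length (Ω p)                    ≡⟨ ∑-grid-const n _ ⟩
    n * (n * length (Ω p))                          ∎
    where open ≡-Reasoning

  second-moment : Prime p → ∀ n → n ≤ p →
    p * (∑[ t ∈ Ω p ] sizeA p n t * sizeA p n t) ≤ n * (n * (length (Ω p) + n * (n * p ^ 4)))
  second-moment p-prime n n≤p = begin
    p * (∑[ t ∈ Ω p ] sizeA p n t * sizeA p n t)
      ≡⟨ cong (p *_) (∑-cong square (Ω p)) ⟩
    p * (∑[ t ∈ Ω p ] ∑[ P ∈ G ] ∑[ Q ∈ G ] 𝟙A t P * 𝟙A t Q)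
      ≡⟨ cong (p *_) (trans (∑-comm (λ t P → ∑[ Q ∈ G ] 𝟙A t P * 𝟙A t Q) (Ω p) G)
                            (∑-cong (λ P → ∑-comm (λ t Q → 𝟙A t P * 𝟙A t Q) (Ω p) G) G)) ⟩
    p * (∑[ P ∈ G ] ∑[ Q ∈ G ] ∑[ t ∈ Ω p ] 𝟙A t P * 𝟙A t Q)
      ≡⟨ trans (*-distribˡ-∑ p _ G) (∑-cong (λ P → *-distribˡ-∑ p _ G) G) ⟩
    ∑[ P ∈ G ] ∑[ Q ∈ G ] p * (∑[ t ∈ Ω p ] 𝟙A t P * 𝟙A t Q)
      ≤⟨ ∑-mono-∈ (λ P∈G → ∑-mono-∈ (λ Q∈G → pair P∈G Q∈G)) ⟩
    ∑[ P ∈ G ] ∑[ Q ∈ G ] (T * 𝟙 (P ≟² Q) + p⁴)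
      ≡⟨ ∑-cong (λ P → trans (∑-distrib-+ G) (cong₂ _+_ (sym (*-distribˡ-∑ T _ G)) (∑-grid-const n p⁴))) G ⟩
    ∑[ P ∈ G ] (T * (∑[ Q ∈ G ] 𝟙 (P ≟² Q)) + n * (n * p⁴))
      ≤⟨ ∑-mono (λ P → +-monoˡ-≤ _ (≤-trans (*-monoʳ-≤ T (∑𝟙≟≤1 _≟²_ unique-G P)) (≤-reflexive (*-identityʳ T)))) G ⟩
    ∑[ P ∈ G ] (T + n * (n * p⁴))
      ≡⟨ ∑-grid-const n _ ⟩
    n * (n * (T + n * (n * p⁴)))
      ∎
    where
    open ≤-Reasoning
    G = grid n
    T = length (Ω p)
    p⁴ = p ^ 4
    square : ∀ t → sizeA p n t * sizeA p n t ≡ ∑[ P ∈ G ] ∑[ Q ∈ G ] 𝟙A t P * 𝟙A t Q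
    square t = trans (cong₂ _*_ (sizeA≡∑𝟙A n t) (sizeA≡∑𝟙A n t)) (∑*∑ (𝟙A t) (𝟙A t) G G)
    unique-G = cartesianProduct⁺ (upTo⁺ n) (upTo⁺ n)
    below : ∀ {x} → x ∈ upTo n → x < p
    below x∈ = <-≤-trans (∈-upTo⁻ x∈) n≤p
    pair : ∀ {P Q} → P ∈ G → Q ∈ G → p * (∑[ t ∈ Ω p ] 𝟙A t P * 𝟙A t Q) ≤ T * 𝟙 (P ≟² Q) + p⁴
    pair P∈G Q∈G with x∈ , y∈ ← ∈-cartesianProduct⁻ (upTo n) (upTo n) P∈G
                    | x′∈ , y′∈ ← ∈-cartesianProduct⁻ (upTo n) (upTo n) Q∈G =
      p*∑𝟙A*𝟙A≤ p-prime (below x∈) (below y∈) (below x′∈) (below y′∈)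

-- Numerical estimates

p⁵≤2T : ∀ {p T s} → 4 ≤ p → T + s ≡ p ^ 5 → s ≤ 2 * p ^ 4 → p ^ 5 ≤ 2 * T
p⁵≤2T {p} {T} {s} 4≤p T+s≡p⁵ s≤2p⁴ = +-cancelʳ-≤ (2 * s) (p ^ 5) (2 * T) (begin
  p ^ 5 + 2 * s             ≤⟨ +-monoʳ-≤ (p ^ 5) (*-monoʳ-≤ 2 s≤2p⁴) ⟩
  p ^ 5 + 2 * (2 * p ^ 4)   ≡⟨ cong (p ^ 5 +_) (*-assoc 2 2 (p ^ 4)) ⟨
  p ^ 5 + 4 * p ^ 4         ≤⟨ +-monoʳ-≤ (p ^ 5) (*-monoˡ-≤ (p ^ 4) 4≤p) ⟩
  p ^ 5 + p ^ 5             ≡⟨ cong (p ^ 5 +_) (+-identityʳ (p ^ 5)) ⟨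
  2 * p ^ 5                 ≡⟨ cong (2 *_) T+s≡p⁵ ⟨
  2 * (T + s)               ≡⟨ *-distribˡ-+ 2 T s ⟩
  2 * T + 2 * s             ∎)
  where open ≤-Reasoning

sum-of-squares-bound : ∀ {n p T s S₁ S₂ U} →
  U + 2 * (p * (n * n)) * S₁ ≡ p * p * S₂ + n * n * (n * n) * T →
  p * S₁ ≡ n * (n * T) →
  p * S₂ ≤ n * (n * (T + n * (n * p ^ 4))) →
  T + s ≡ p ^ 5 →
  U ≤ p * (n * n) * T + n * n * (n * n) * s
sum-of-squares-bound {n} {p} {T} {s} {S₁} {S₂} {U} variance first second T+s≡p⁵ =
  +-cancelʳ-≤ (N² * T + N² * T) U (p * N * T + N² * s) (begin
    U + (N² * T + N² * T)                    ≡⟨ cong (U +_) cross-term ⟨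
    U + 2 * (p * N) * S₁                     ≡⟨ variance ⟩
    p * p * S₂ + N² * T                      ≡⟨ cong (_+ N² * T) (*-assoc p p S₂) ⟩
    p * (p * S₂) + N² * T                    ≤⟨ +-monoˡ-≤ (N² * T) (*-monoʳ-≤ p second) ⟩
    p * (n * (n * (T + n * (n * p ^ 4)))) + N² * T
                                             ≡⟨ expand n p T (p ^ 4) ⟩
    p * N * T + N² * p ^ 5 + N² * T          ≡⟨ cong (λ m → p * N * T + N² * m + N² * T) T+s≡p⁵ ⟨
    p * N * T + N² * (T + s) + N² * T        ≡⟨ regroup (p * N * T) N² T s ⟩
    p * N * T + N² * s + (N² * T + N² * T)   ∎)
  where
  open ≤-Reasoning
  N = n * n
  N² = n * n * (n * n)
  cross-term : 2 * (p * N) * S₁ ≡ N² * T + N² * T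
  cross-term = begin-equality
    2 * (p * N) * S₁      ≡⟨ swap-p 2 p N S₁ ⟩
    2 * N * (p * S₁)      ≡⟨ cong (2 * N *_) first ⟩
    2 * N * (n * (n * T)) ≡⟨ double n T ⟩
    N² * T + N² * T       ∎
    where
    swap-p : ∀ a p N S → a * (p * N) * S ≡ a * N * (p * S)
    swap-p = solve-∀
    double : ∀ n T → 2 * (n * n) * (n * (n * T)) ≡ n * n * (n * n) * T + n * n * (n * n) * T
    double = solve-∀
  expand : ∀ n p T q → p * (n * (n * (T + n * (n * q)))) + n * n * (n * n) * T
                     ≡ p * (n * n) * T + n * n * (n * n) * (p * q) + n * n * (n * n) * T
  expand = solve-∀
  regroup : ∀ a b T s → a + b * (T + s) + b * T ≡ a + b * s + (b * T + b * T)
  regroup = solve-∀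

mean-square-bound : ∀ {n p T s} → 1 ≤ n → 4 * n < p → s ≤ 2 * p ^ 4 → T + s ≡ p ^ 5 →
  10 * (p * (n * n) * T + n * n * (n * n) * s) ≤ 10 * 10 * n * (p * p) * T
mean-square-bound {n} {p} {T} {s} 1≤n 4n<p s≤2p⁴ T+s≡p⁵ = begin
  10 * (p * (n * n) * T + n * n * (n * n) * s)      ≡⟨ *-distribˡ-+ 10 (p * (n * n) * T) (n * n * (n * n) * s) ⟩
  10 * (p * (n * n) * T) + 10 * (n * n * (n * n) * s)
    ≤⟨ +-mono-≤ (*-monoʳ-≤ 10 linear-term) quartic-term ⟩
  10 * (n * (p * p) * T) + 90 * (n * (p * p) * T)   ≡⟨ sum n p T ⟩
  10 * 10 * n * (p * p) * T                          ∎
  where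
  open ≤-Reasoning
  4n≤p = <⇒≤ 4n<p
  n≤p : n ≤ p
  n≤p = ≤-trans (m≤n*m n 4) 4n≤p
  4≤p : 4 ≤ p
  4≤p = ≤-trans (*-monoʳ-≤ 4 1≤n) 4n≤p
  linear-term : p * (n * n) * T ≤ n * (p * p) * T
  linear-term = begin
    p * (n * n) * T   ≤⟨ *-monoˡ-≤ T (*-monoʳ-≤ p (*-monoʳ-≤ n n≤p)) ⟩
    p * (n * p) * T   ≡⟨ cong (_* T) (*-Props.x∙yz≈y∙xz p n p) ⟩
    n * (p * p) * T   ∎
  -- (4 n)³ ≤ p³ and p⁵ ≤ 2 T turn n⁴ p⁴ into a multiple of n p² T.
  quartic-term : 10 * (n * n * (n * n) * s) ≤ 90 * (n * (p * p) * T)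
  quartic-term = *-cancelˡ-≤ 64 (begin
    64 * (10 * (n * n * (n * n) * s))                 ≤⟨ *-monoʳ-≤ 64 (*-monoʳ-≤ 10 (*-monoʳ-≤ (n * n * (n * n)) s≤2p⁴)) ⟩
    64 * (10 * (n * n * (n * n) * (2 * p ^ 4)))       ≡⟨ e₁ n (p ^ 4) ⟩
    20 * n * p ^ 4 * (4 * n * (4 * n * (4 * n)))       ≤⟨ *-monoʳ-≤ (20 * n * p ^ 4) (*-mono-≤ 4n≤p (*-mono-≤ 4n≤p 4n≤p)) ⟩
    20 * n * p ^ 4 * (p * (p * p))                     ≡⟨ e₂ n p (p ^ 4) ⟩
    20 * n * (p * p) * p ^ 5                           ≤⟨ *-monoʳ-≤ (20 * n * (p * p)) (p⁵≤2T 4≤p T+s≡p⁵ s≤2p⁴) ⟩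
    20 * n * (p * p) * (2 * T)                         ≡⟨ e₃ n p T ⟩
    40 * (n * (p * p) * T)                             ≤⟨ *-monoˡ-≤ (n * (p * p) * T) (m≤m+n 40 5720) ⟩
    5760 * (n * (p * p) * T)                           ≡⟨ *-assoc 64 90 (n * (p * p) * T) ⟩
    64 * (90 * (n * (p * p) * T))                      ∎)
    where
    e₁ : ∀ n q → 64 * (10 * (n * n * (n * n) * (2 * q))) ≡ 20 * n * q * (4 * n * (4 * n * (4 * n)))
    e₁ = solve-∀
    e₂ : ∀ n p q → 20 * n * q * (p * (p * p)) ≡ 20 * n * (p * p) * (p * q)
    e₂ = solve-∀
    e₃ : ∀ n p T → 20 * n * (p * p) * (2 * T) ≡ 40 * (n * (p * p) * T)
    e₃ = solve-∀
  sum : ∀ n p T → 10 * (n * (p * p) * T) + 90 * (n * (p * p) * T) ≡ 10 * 10 * n * (p * p) * T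
  sum = solve-∀

close⇒≤2n : ∀ {n p X} → 100 ≤ n → n ≤ p → ∣ X * p - n * n ∣ ^ 2 ≤ 10 * 10 * n * (p * p) → X ≤ 2 * n
close⇒≤2n {n} {p} {X} 100≤n n≤p close = ≮⇒≥ (λ 2n<X → <⇒≱ (n<100 2n<X) 100≤n)
  where
  D = ∣ X * p - n * n ∣
  n<100 : 2 * n < X → n < 100
  n<100 2n<X = *-cancelʳ-< (n * (p * p)) n 100 (begin-strict
    n * (n * (p * p))    ≡⟨ e₁ n p ⟩
    n * p * (n * p)      <⟨ *-mono-< np<D np<D ⟩
    D * D                ≡⟨ cong (D *_) (*-identityʳ D) ⟨
    D ^ 2                ≤⟨ close ⟩
    10 * 10 * n * (p * p) ≡⟨ *-assoc 100 n (p * p) ⟩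
    100 * (n * (p * p))  ∎)
    where
    open ≤-Reasoning
    e₁ : ∀ n p → n * (n * (p * p)) ≡ n * p * (n * p)
    e₁ = solve-∀
    e₂ : ∀ n p → suc (2 * n) * p ≡ n * p + p + n * p
    e₂ = solve-∀
    np<D : n * p < D
    np<D = <-≤-trans (m<m+n (n * p) (<-≤-trans z<s (≤-trans 100≤n n≤p))) (+-cancelʳ-≤ (n * p) _ _ (begin
      n * p + p + n * p    ≡⟨ e₂ n p ⟨
      suc (2 * n) * p      ≤⟨ *-monoˡ-≤ p 2n<X ⟩
      X * p                ≤⟨ m≤∣m-n∣+n (X * p) (n * n) ⟩
      D + n * n            ≤⟨ +-monoʳ-≤ D (*-monoʳ-≤ n n≤p) ⟩
      D + n * p            ∎))

close⇒n≤16X : ∀ {n p X} → 25600 ≤ n → n ≤ p → p < 8 * n → ∣ X * p - n * n ∣ ^ 2 ≤ 10 * 10 * n * (p * p) → n ≤ 16 * X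
close⇒n≤16X {n} {p} {X} 25600≤n n≤p p<8n close = ≮⇒≥ (λ 16X<n → <⇒≱ (n<25600 16X<n) 25600≤n)
  where
  D = ∣ X * p - n * n ∣
  instance
    n≢0 : NonZero n
    n≢0 = >-nonZero (<-≤-trans z<s 25600≤n)
    p≢0 : NonZero p
    p≢0 = >-nonZero (<-≤-trans z<s (≤-trans 25600≤n n≤p))
  n<25600 : 16 * X < n → n < 25600
  n<25600 16X<n = *-cancelʳ-< (n * (n * n)) n 25600 (begin-strict
    n * (n * (n * n))               ≡⟨ e₁ n ⟩
    n * n * (n * n)                 <⟨ *-mono-< n²<2D n²<2D ⟩
    2 * D * (2 * D)                 ≡⟨ e₂ D ⟩
    4 * (D * (D * 1))               ≤⟨ *-monoʳ-≤ 4 close ⟩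
    4 * (10 * 10 * n * (p * p))     ≡⟨ e₆ n p ⟩
    400 * n * (p * p)               <⟨ *-monoʳ-< (400 * n) {{m*n≢0 400 n}} (*-mono-< p<8n p<8n) ⟩
    400 * n * (8 * n * (8 * n))     ≡⟨ e₃ n ⟩
    25600 * (n * (n * n))           ∎)
    where
    open ≤-Reasoning
    e₁ : ∀ n → n * (n * (n * n)) ≡ n * n * (n * n)
    e₁ = solve-∀
    e₂ : ∀ D → 2 * D * (2 * D) ≡ 4 * (D * (D * 1))
    e₂ = solve-∀
    e₆ : ∀ n p → 4 * (10 * 10 * n * (p * p)) ≡ 400 * n * (p * p)
    e₆ = solve-∀
    e₃ : ∀ n → 400 * n * (8 * n * (8 * n)) ≡ 25600 * (n * (n * n))
    e₃ = solve-∀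
    2Xp<n² : 2 * (X * p) < n * n
    2Xp<n² = *-cancelˡ-< 8 _ _ (begin-strict
      8 * (2 * (X * p))   ≡⟨ e₄ X p ⟩
      16 * X * p          <⟨ *-monoˡ-< p 16X<n ⟩
      n * p               <⟨ *-monoʳ-< n p<8n ⟩
      n * (8 * n)         ≡⟨ e₅ n ⟩
      8 * (n * n)         ∎)
      where
      e₄ : ∀ X p → 8 * (2 * (X * p)) ≡ 16 * X * p
      e₄ = solve-∀
      e₅ : ∀ n → n * (8 * n) ≡ 8 * (n * n)
      e₅ = solve-∀
    n²<2D : n * n < 2 * D
    n²<2D = +-cancelʳ-< (n * n) (n * n) (2 * D) (begin-strict
      n * n + n * n       ≡⟨ cong (n * n +_) (+-identityʳ (n * n)) ⟨
      2 * (n * n)         ≤⟨ *-monoʳ-≤ 2 (subst (λ d → n * n ≤ d + X * p) (∣-∣-comm (n * n) (X * p)) (m≤∣m-n∣+n (n * n) (X * p))) ⟩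
      2 * (D + X * p)     ≡⟨ *-distribˡ-+ 2 D (X * p) ⟩
      2 * D + 2 * (X * p) <⟨ +-monoʳ-< (2 * D) 2Xp<n² ⟩
      2 * D + n * n       ∎)

module _ (n p : ℕ) .{{_ : NonZero p}} (1≤n : 1 ≤ n) (p-prime : Prime p) (4n<p : 4 * n < p) where

  open Moments p

  private
    n≤p : n ≤ p
    n≤p = ≤-trans (m≤n*m n 4) (<⇒≤ 4n<p)

  concentration : WithProb≥9/10 p (λ t → ∣ sizeA p n t * p - n * n ∣ ^ 2 ≤? 10 * 10 * n * (p * p))
  concentration = markov-9/10 D² (10 * 10 * n * (p * p)) {{K≢0}} (Ω p) (begin
    10 * ∑ (Ω p) D²                                          ≤⟨ *-monoʳ-≤ 10 ∑D²≤ ⟩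
    10 * (p * (n * n) * T + n * n * (n * n) * #singular)     ≤⟨ mean-square-bound 1≤n 4n<p (#singular≤2p⁴ p-prime) |Ω|+#singular≡p⁵ ⟩
    10 * 10 * n * (p * p) * T                                ∎)
    where
    open ≤-Reasoning
    X = sizeA p n
    T = length (Ω p)
    D² : Tuple5 → ℕ
    D² t = ∣ X t * p - n * n ∣ ^ 2
    K≢0 : NonZero (10 * 10 * n * (p * p))
    K≢0 = m*n≢0 (10 * 10 * n) (p * p) {{m*n≢0 100 n {{_}} {{>-nonZero 1≤n}}}} {{m*n≢0 p p}}
    ∑D²≤ : ∑ (Ω p) D² ≤ p * (n * n) * T + n * n * (n * n) * #singular
    ∑D²≤ = sum-of-squares-bound {n} {p} {T} {#singular} {∑ (Ω p) X} {S₂ = ∑[ t ∈ Ω p ] X t * X t}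
      (∑∣f*p-c∣² X p (n * n) (Ω p)) (first-moment n) (second-moment p-prime n n≤p) |Ω|+#singular≡p⁵

  size-bounds : 25600 ≤ n → p < 8 * n →
    WithProb≥9/10 p (λ t → (n ≤? 16 * sizeA p n t) ×-dec (sizeA p n t ≤? 2 * n))
  size-bounds 25600≤n p<8n = ≤-trans concentration (*-monoʳ-≤ 10 (length-filter-mono _ _ both (Ω p)))
    where
    100≤n : 100 ≤ n
    100≤n = ≤-trans (m≤m+n 100 25500) 25600≤n
    both : ∀ t → ∣ sizeA p n t * p - n * n ∣ ^ 2 ≤ 10 * 10 * n * (p * p) → n ≤ 16 * sizeA p n t × sizeA p n t ≤ 2 * n
    both t close = close⇒n≤16X {X = sizeA p n t} 25600≤n n≤p p<8n close , close⇒≤2n {X = sizeA p n t} 100≤n n≤p close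

lemma1p5 : Σ ℕ λ C → 1 ≤ C × Σ ℕ λ N₀ → Σ ℕ λ k → 1 ≤ k × Σ ℕ λ c₂ → 1 ≤ c₂ ×
    ((n p : ℕ) → .{{_ : NonZero p}} → 1 ≤ n → Prime p → 4 * n < p → p < 8 * n →
      WithProb≥9/10 p (λ t → (∣ sizeA p n t * p - n * n ∣ ^ 2) ≤? (C * C * n * (p * p)))
      × (N₀ ≤ n → WithProb≥9/10 p (λ t → (n ≤? k * sizeA p n t) ×-dec (sizeA p n t ≤? c₂ * n))))
lemma1p5 = 10 , s≤s z≤n , 25600 , 16 , s≤s z≤n , 2 , s≤s z≤n , λ n p 1≤n p-prime 4n<p p<8n →
  concentration n p 1≤n p-prime 4n<p , λ 25600≤n → size-bounds n p 1≤n p-prime 4n<p 25600≤n p<8n
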